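{- For every integer $b\ge 2$, there exists a prime $p\ge 5$ such that $b$ has even order in the multiplicative group of integers modulo $p^2$. -}

module Defs where

open import Data.Nat using (ℕ; _^_; _<_; _∸_)
open import Data.Nat.Divisibility using (_∣_)
open import Data.Empty using (⊥)

-- b ^ k ≡ 1 (mod m), for b ≥ 1 (so b ^ k ≥ 1 and truncated subtraction is exact)
PowIsOne : ℕ → ℕ → ℕ → Set
PowIsOne m b k = m ∣ (b ^ k ∸ 1)

record MulOrder (m b k : ℕ) : Set where
  field
    positive : 0 < k
    isOne    : PowIsOne m b k
    minimal  : ∀ j → 0 < j → j < k → PowIsOne m b j → ⊥

Even : ℕ → Set
Even n = 2 ∣ n

{-# OPTIONS --safe #-}
-- Pick a prime p ≥ 5 dividing b² + 1: the odd part of b² + 1 exceeds 1, and 3 never divides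
-- n² + 1. Then b² ≡ -1 (mod p), so b⁴ ≡ 1 (mod p), and since (1 + a)ⁿ ≡ 1 + n a (mod a²),
-- raising to the p-th power gives b^(4p) ≡ 1 (mod p²); so b has an order k modulo p².
-- If k were odd, b^(2k) would be ≡ 1 (from b^k ≡ 1) and ≡ (-1)^k = -1 (from b² ≡ -1)
-- modulo p, forcing p ∣ 2.
module Submission where

open import Defs
open import Data.Nat using (ℕ; zero; suc; _+_; _*_; _∸_; _^_; _≤_; _<_; z≤n; s≤s; z<s; _%_; _/_)
open import Data.Nat.Properties
open import Data.Nat.DivMod using (m≡m%n+[m/n]*n; m%n<n)
open import Data.Nat.Divisibility
  using (_∣_; divides; _∣?_; _∣0; 1∣_; ∣-refl; ∣-reflexive; ∣-trans; >⇒∤; ∣m∣n⇒∣m+n; ∣m+n∣m⇒∣n;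
         m∣m*n; n∣m*n; ∣m⇒∣m*n; ∣n⇒∣m*n; *-pres-∣)
open import Data.Nat.Primality using (Prime; ¬prime[1])
open import Data.Nat.Primality.Factorisation using (factorise)
open import Data.Nat.Tactic.RingSolver using (solve-∀)
open import Data.List using ([]; _∷_)
open import Data.List.Relation.Unary.All using (_∷_)
open import Data.Product using (∃; _×_; _,_)
open import Data.Sum using (_⊎_; inj₁; inj₂)
open import Relation.Nullary using (¬_; yes; no; contradiction)
open import Relation.Nullary.Decidable using (from-no)
open import Relation.Unary using (Decidable)
open import Relation.Binary.PropositionalEquality
  using (_≡_; _≢_; refl; sym; trans; cong; subst; subst₂; module ≡-Reasoning)

even-or-odd : ∀ n → (∃ λ j → n ≡ 2 * j) ⊎ (∃ λ j → n ≡ 1 + 2 * j)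
even-or-odd zero = inj₁ (0 , refl)
even-or-odd (suc n) with even-or-odd n
... | inj₁ (j , n≡2j)   = inj₂ (j , cong suc n≡2j)
... | inj₂ (j , n≡1+2j) = inj₁ (suc j , trans (cong suc n≡1+2j) (sym (*-suc 2 j)))

2∤1+2*j : ∀ j → ¬ 2 ∣ 1 + 2 * j
2∤1+2*j j (divides q 1+2j≡q*2) = even≢odd q j (sym (trans 1+2j≡q*2 (*-comm q 2)))

[1+a]^n≡1+n*a+a*a*r : ∀ a n → ∃ λ r → (1 + a) ^ n ≡ 1 + (n * a + a * a * r)
[1+a]^n≡1+n*a+a*a*r a zero = 0 , cong suc (sym (*-zeroʳ (a * a)))
[1+a]^n≡1+n*a+a*a*r a (suc n) with [1+a]^n≡1+n*a+a*a*r a n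
... | r , eq = r + n + a * r , trans (cong ((1 + a) *_) eq) (expand a n r)
  where
  expand : ∀ a n r → (1 + a) * (1 + (n * a + a * a * r)) ≡ 1 + ((1 + n) * a + a * a * (r + n + a * r))
  expand = solve-∀

a∣[1+a]^n∸1 : ∀ a n → a ∣ (1 + a) ^ n ∸ 1
a∣[1+a]^n∸1 a n with [1+a]^n≡1+n*a+a*a*r a n
... | r , eq rewrite eq = ∣m∣n⇒∣m+n (n∣m*n n) (∣m⇒∣m*n r (m∣m*n a))

d∣a∧d∣n⇒d*d∣[1+a]^n∸1 : ∀ {d} a n → d ∣ a → d ∣ n → d * d ∣ (1 + a) ^ n ∸ 1
d∣a∧d∣n⇒d*d∣[1+a]^n∸1 a n d∣a d∣n with [1+a]^n≡1+n*a+a*a*r a n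
... | r , eq rewrite eq = ∣m∣n⇒∣m+n (*-pres-∣ d∣n d∣a) (∣m⇒∣m*n r (*-pres-∣ d∣a d∣a))

d∣x∸1⇒d∣x^n∸1 : ∀ {d} x n → d ∣ x ∸ 1 → d ∣ x ^ n ∸ 1
d∣x∸1⇒d∣x^n∸1 zero    zero    _   = _ ∣0
d∣x∸1⇒d∣x^n∸1 zero    (suc n) _   = _ ∣0
d∣x∸1⇒d∣x^n∸1 (suc a) n       d∣a = ∣-trans d∣a (a∣[1+a]^n∸1 a n)

d∣x∸1∧d∣n⇒d*d∣x^n∸1 : ∀ {d} x n → d ∣ x ∸ 1 → d ∣ n → d * d ∣ x ^ n ∸ 1
d∣x∸1∧d∣n⇒d*d∣x^n∸1 zero    zero    _   _   = _ ∣0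
d∣x∸1∧d∣n⇒d*d∣x^n∸1 zero    (suc n) _   _   = _ ∣0
d∣x∸1∧d∣n⇒d*d∣x^n∸1 (suc a) n       d∣a d∣n = d∣a∧d∣n⇒d*d∣[1+a]^n∸1 a n d∣a d∣n

x+1∣x^2∸1 : ∀ x → x + 1 ∣ x ^ 2 ∸ 1
x+1∣x^2∸1 zero    = _ ∣0
x+1∣x^2∸1 (suc a) = divides a (factor a)
  where
  factor : ∀ a → a * 1 + a * suc (a * 1) ≡ a * (suc a + 1)
  factor = solve-∀

x+1∣x^[1+2j]+1 : ∀ x j → x + 1 ∣ x ^ (1 + 2 * j) + 1
x+1∣x^[1+2j]+1 x zero = ∣-reflexive (cong (_+ 1) (sym (*-identityʳ x)))
x+1∣x^[1+2j]+1 x (suc j) =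
  subst (λ e → x + 1 ∣ x ^ e + 1) (sym (cong suc (*-suc 2 j)))
    (∣m+n∣m⇒∣n (subst (x + 1 ∣_) (sym (regroup x (x ^ (1 + 2 * j))))
                  (∣m∣n⇒∣m+n (∣n⇒∣m*n (x * x) (x+1∣x^[1+2j]+1 x j)) ∣-refl))
               (n∣m*n x))
  where
  regroup : ∀ x y → x * (x + 1) + (x * (x * y) + 1) ≡ x * x * (y + 1) + (x + 1)
  regroup = solve-∀

d∣x∸1∧d∣x+1⇒d∣2 : ∀ {d} x → d ∣ x ∸ 1 → d ∣ x + 1 → d ∣ 2
d∣x∸1∧d∣x+1⇒d∣2 zero    _   d∣1     = ∣-trans d∣1 (1∣ 2)
d∣x∸1∧d∣x+1⇒d∣2 {d} (suc a) d∣a d∣a+2 = ∣m+n∣m⇒∣n (subst (d ∣_) (sym (+-suc a 1)) d∣a+2) d∣a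

module _ {ℓ} {P : ℕ → Set ℓ} (P? : Decidable P) where

  NoneBelow : ℕ → Set ℓ
  NoneBelow n = ∀ j → 0 < j → j < n → ¬ P j

  none-below-suc : ∀ {n} → NoneBelow n → ¬ P n → NoneBelow (suc n)
  none-below-suc none ¬Pn j 0<j j<1+n with m<1+n⇒m<n∨m≡n j<1+n
  ... | inj₁ j<n  = none j 0<j j<n
  ... | inj₂ refl = ¬Pn

  none-below-or-least : ∀ n → NoneBelow n ⊎ ∃ λ k → 0 < k × P k × NoneBelow k
  none-below-or-least zero = inj₁ λ _ _ ()
  none-below-or-least (suc zero) = inj₁ λ { zero () ; (suc _) _ (s≤s ()) }
  none-below-or-least (suc n@(suc _)) with none-below-or-least n
  ... | inj₂ least = inj₂ least
  ... | inj₁ none with P? n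
  ...   | yes Pn  = inj₂ (n , z<s , Pn , none)
  ...   | no ¬Pn  = inj₁ (none-below-suc none ¬Pn)

  least-positive : ∀ {n} → 0 < n → P n → ∃ λ k → 0 < k × P k × NoneBelow k
  least-positive {n} 0<n Pn with none-below-or-least (suc n)
  ... | inj₁ none  = contradiction Pn (none n 0<n (n<1+n n))
  ... | inj₂ least = least

mulOrder-exists : ∀ {m b n} → 0 < n → PowIsOne m b n → ∃ (MulOrder m b)
mulOrder-exists {m} {b} 0<n b^n≡1 with least-positive (λ k → m ∣? b ^ k ∸ 1) 0<n b^n≡1
... | k , 0<k , b^k≡1 , minimal =
  k , record { positive = 0<k ; isOne = b^k≡1 ; minimal = minimal }

module _ {d b : ℕ} (d∣b²+1 : d ∣ b ^ 2 + 1) where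
  open ≡-Reasoning

  d^2∣b^[4*d]∸1 : d ^ 2 ∣ b ^ (4 * d) ∸ 1
  d^2∣b^[4*d]∸1 = subst₂ (λ e f → e ∣ f ∸ 1) (cong (d *_) (sym (*-identityʳ d))) exponent
    (d∣x∸1∧d∣n⇒d*d∣x^n∸1 ((b ^ 2) ^ 2) d (∣-trans d∣b²+1 (x+1∣x^2∸1 (b ^ 2))) ∣-refl)
    where
    exponent : ((b ^ 2) ^ 2) ^ d ≡ b ^ (4 * d)
    exponent = begin
      ((b ^ 2) ^ 2) ^ d ≡⟨ cong (_^ d) (^-*-assoc b 2 2) ⟩
      (b ^ 4) ^ d       ≡⟨ ^-*-assoc b 4 d ⟩
      b ^ (4 * d)       ∎

  d∣b^[1+2j]∸1⇒d∣2 : ∀ j → d ∣ b ^ (1 + 2 * j) ∸ 1 → d ∣ 2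
  d∣b^[1+2j]∸1⇒d∣2 j d∣b^k∸1 = d∣x∸1∧d∣x+1⇒d∣2 ((b ^ 2) ^ k)
    (subst (λ e → d ∣ e ∸ 1) exponent (d∣x∸1⇒d∣x^n∸1 (b ^ k) 2 d∣b^k∸1))
    (∣-trans d∣b²+1 (x+1∣x^[1+2j]+1 (b ^ 2) j))
    where
    k : ℕ
    k = 1 + 2 * j
    exponent : (b ^ k) ^ 2 ≡ (b ^ 2) ^ k
    exponent = begin
      (b ^ k) ^ 2 ≡⟨ ^-*-assoc b k 2 ⟩
      b ^ (k * 2) ≡⟨ cong (b ^_) (*-comm k 2) ⟩
      b ^ (2 * k) ≡⟨ ^-*-assoc b 2 k ⟨
      (b ^ 2) ^ k ∎

  d∤2⇒even-exponent : ∀ {k} → ¬ d ∣ 2 → d ∣ b ^ k ∸ 1 → Even k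
  d∤2⇒even-exponent {k} d∤2 d∣b^k∸1 with even-or-odd k
  ... | inj₁ (j , refl) = divides j (*-comm 2 j)
  ... | inj₂ (j , refl) = contradiction (d∣b^[1+2j]∸1⇒d∣2 j d∣b^k∸1) d∤2

  d∣b⇒d∣1 : d ∣ b → d ∣ 1
  d∣b⇒d∣1 d∣b = ∣m+n∣m⇒∣n d∣b²+1 (∣m⇒∣m*n (b * 1) d∣b)

  even-order-mod-d^2 : 2 < d → ∃ λ k → MulOrder (d ^ 2) b k × Even k
  even-order-mod-d^2 2<d with mulOrder-exists (*-monoʳ-< 4 (<-trans z<s 2<d)) d^2∣b^[4*d]∸1
  ... | k , order = k , order , d∤2⇒even-exponent (>⇒∤ 2<d) d∣b^k∸1
    where
    d∣b^k∸1 : d ∣ b ^ k ∸ 1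
    d∣b^k∸1 = ∣-trans (m∣m*n (d ^ 1)) (MulOrder.isOne order)

3∤n^2+1 : ∀ n → ¬ 3 ∣ n ^ 2 + 1
3∤n^2+1 n 3∣n²+1 = 3∤r^2+1 r (m%n<n n 3) (∣m+n∣m⇒∣n 3∣ (m∣m*n (q * (2 * r + q * 3))))
  where
  r q : ℕ
  r = n % 3
  q = n / 3
  expand : ∀ x y → (x + y * 3) * ((x + y * 3) * 1) + 1 ≡ 3 * (y * (2 * x + y * 3)) + (x * (x * 1) + 1)
  expand = solve-∀
  3∣ : 3 ∣ 3 * (q * (2 * r + q * 3)) + (r ^ 2 + 1)
  3∣ = subst (3 ∣_) (trans (cong (λ e → e ^ 2 + 1) (m≡m%n+[m/n]*n n 3)) (expand r q)) 3∣n²+1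
  3∤r^2+1 : ∀ x → x < 3 → ¬ 3 ∣ x ^ 2 + 1
  3∤r^2+1 0 _ = from-no (3 ∣? 1)
  3∤r^2+1 1 _ = from-no (3 ∣? 2)
  3∤r^2+1 2 _ = from-no (3 ∣? 5)
  3∤r^2+1 (suc (suc (suc _))) (s≤s (s≤s (s≤s ())))

odd-divisor-of-n^2+1 : ∀ n → 2 ≤ n → ∃ λ j → 1 ≤ j × 1 + 2 * j ∣ n ^ 2 + 1
odd-divisor-of-n^2+1 n 2≤n with even-or-odd n
... | inj₁ (zero , refl)  = contradiction 2≤n λ ()
... | inj₂ (zero , refl)  = contradiction 2≤n λ { (s≤s ()) }
... | inj₁ (a@(suc _) , refl) = 2 * (a * a) , s≤s z≤n , ∣-reflexive (even-case a)
  where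
  even-case : ∀ a → 1 + 2 * (2 * (a * a)) ≡ (2 * a) * ((2 * a) * 1) + 1
  even-case = solve-∀
... | inj₂ (a@(suc _) , refl) = a * a + a , s≤s z≤n , divides 2 (odd-case a)
  where
  odd-case : ∀ a → (1 + 2 * a) * ((1 + 2 * a) * 1) + 1 ≡ 2 * (1 + 2 * (a * a + a))
  odd-case = solve-∀

prime-divisor : ∀ {n} → 2 ≤ n → ∃ λ p → Prime p × p ∣ n
prime-divisor {1} (s≤s ())
prime-divisor {n@(suc (suc _))} _ with factorise n
... | record { factors = [] ; isFactorisation = () }
... | record { factors = p ∷ _ ; isFactorisation = n≡p*ps ; factorsPrime = p-prime ∷ _ } =
  p , p-prime , subst (p ∣_) (sym n≡p*ps) (m∣m*n _)

prime∧2∤p∧p≢3⇒5≤p : ∀ {p} → Prime p → ¬ 2 ∣ p → p ≢ 3 → 5 ≤ p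
prime∧2∤p∧p≢3⇒5≤p {0} _       2∤0 _   = contradiction (2 ∣0) 2∤0
prime∧2∤p∧p≢3⇒5≤p {1} 1-prime _   _   = contradiction 1-prime ¬prime[1]
prime∧2∤p∧p≢3⇒5≤p {2} _       2∤2 _   = contradiction ∣-refl 2∤2
prime∧2∤p∧p≢3⇒5≤p {3} _       _   3≢3 = contradiction refl 3≢3
prime∧2∤p∧p≢3⇒5≤p {4} _       2∤4 _   = contradiction (divides 2 refl) 2∤4
prime∧2∤p∧p≢3⇒5≤p {suc (suc (suc (suc (suc n))))} _ _ _ = m≤m+n 5 n

prime≥5∣n^2+1 : ∀ n → 2 ≤ n → ∃ λ p → Prime p × 5 ≤ p × p ∣ n ^ 2 + 1
prime≥5∣n^2+1 n 2≤n with odd-divisor-of-n^2+1 n 2≤n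
... | j , 1≤j , c∣n²+1 with prime-divisor (m≤n⇒m≤1+n (*-monoʳ-≤ 2 1≤j))
... | p , p-prime , p∣c = p , p-prime , 5≤p , p∣n²+1
  where
  p∣n²+1 : p ∣ n ^ 2 + 1
  p∣n²+1 = ∣-trans p∣c c∣n²+1
  5≤p : 5 ≤ p
  5≤p = prime∧2∤p∧p≢3⇒5≤p p-prime
    (λ 2∣p → 2∤1+2*j j (∣-trans 2∣p p∣c))
    (λ p≡3 → 3∤n^2+1 n (subst (_∣ n ^ 2 + 1) p≡3 p∣n²+1))

mainTheorem6 : (b : ℕ) → 2 ≤ b →
    ∃ λ p → Prime p × 5 ≤ p × ¬ (p ∣ b) ×
      ∃ λ k → MulOrder (p ^ 2) b k × Even k
mainTheorem6 b 2≤b with prime≥5∣n^2+1 b 2≤b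
... | p , p-prime , 5≤p , p∣b²+1 =
  p , p-prime , 5≤p , p∤b , even-order-mod-d^2 p∣b²+1 2<p
  where
  2<p : 2 < p
  2<p = ≤-trans (s≤s (s≤s (s≤s z≤n))) 5≤p
  p∤b : ¬ p ∣ b
  p∤b p∣b = >⇒∤ (<-trans (n<1+n 1) 2<p) (d∣b⇒d∣1 p∣b²+1 p∣b)
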